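{- Let $F:[n]^\ell\to\mathbb{R}$ be permutation-invariant. Then: \begin{enumerate} \item for all $a\in[n]$, all integers $0\le i\le\ell-1$ and all $X\in[n]^i$, $f_{i+1,F}(a,X)=f_{i,F|_{\{a\}}}(X)-f_{i,F}(X)$; \item for all integers $0\le i\le\ell$ and all $X\in[n]^i$, $f_{i,F}(X)=\sum_{B\subseteq\{1,\ldots,i\}}(-1)^{i-|B|}\,\delta_{X|_B}(F)$. \end{enumerate}
   Context: $[n]=\mathbb{Z}/n\mathbb{Z}$, $n>\ell$. Characters: $\chi_t(x)=e^{2\pi itx/n}$ for $t,x\in[n]$, and for $T\in[n]^m$, $\chi_T(X)=\prod_{j}\chi_{T_j}(x_j)$; for $G:[n]^m\to\mathbb{R}$, $\hat G(T)=\mathbb{E}_{X\in[n]^m}[G(X)\overline{\chi_T(X)}]$. For $G:[n]^m\to\mathbb{R}$ and $0\le i\le m$, $f_{i,G}:[n]^i\to\mathbb{C}$ is $f_{i,G}(x_1,\ldots,x_i)=\sum_{(T_1,\ldots,T_i)\in([n]\setminus\{0\})^i}\hat G(T_1,\ldots,T_i,0,\ldots,0)\,\chi_{T_1,\ldots,T_i}(x_1,\ldots,x_i)$. $F$ is permutation-invariant if $F(x_1,\ldots,x_\ell)=F(x_{\pi(1)},\ldots,x_{\pi(\ell)})$ for all permutations $\pi$. For an ordered tuple $A=(a_1,\ldots,a_r)\in[n]^r$ with $1\le r\le\ell-1$, $F|_A:[n]^{\ell-r}\to\mathbb{R}$ is $F|_A(x_1,\ldots,x_{\ell-r})=F(a_1,\ldots,a_r,x_1,\ldots,x_{\ell-r})$,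 and $\delta_A(F)=\mathbb{E}_{X\in[n]^{\ell-r}}[F|_A(X)]$; for $A$ empty, $\delta_A(F)=\mathbb{E}_{X\in[n]^\ell}[F(X)]$. For $X=(x_1,\ldots,x_i)$ and $B=\{k_1<\cdots<k_m\}\subseteq\{1,\ldots,i\}$, $X|_B=(x_{k_1},\ldots,x_{k_m})$. -}

module Defs where

open import Level using (Level)
open import Data.Nat using (ℕ; zero; suc; _∸_; NonZero)
import Data.Nat as ℕ
open import Data.Fin using (Fin; zero; suc; toℕ)
open import Data.Fin.Subset using (Subset; inside; outside)
open import Data.Vec using (Vec; []; _∷_)
open import Data.Bool using (Bool; true; false)
open import Algebra.Bundles using (CommutativeRing)

-- The additive group [n] = ℤ/nℤ is represented by Fin n (representatives 0,…,n-1).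
-- [n]^m is represented by Vec (Fin n) m.

0F : ∀ {n} → .{{NonZero n}} → Fin n
0F {suc n} = zero

size : ∀ {i} → Subset i → ℕ
size [] = zero
size (inside ∷ B) = suc (size B)
size (outside ∷ B) = size B

select : ∀ {a} {A : Set a} {i} → (B : Subset i) → Vec A i → Vec A (size B)
select [] [] = []
select (inside ∷ B) (x ∷ X) = x ∷ select B X
select (outside ∷ B) (x ∷ X) = select B X

-- Fourier analysis on [n]^m with values in a commutative ring R,
-- given an element ω playing the role of e^{2πi/n} and ninv = 1/n.
module Fourier {c ℓ : Level} (R : CommutativeRing c ℓ) (n : ℕ) .{{_ : NonZero n}}
               (ω ninv : CommutativeRing.Carrier R) where
  open CommutativeRing R using (Carrier; _≈_; _+_; _*_; 0#; 1#)

  pow : Carrier → ℕ → Carrier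
  pow x zero = 1#
  pow x (suc k) = x * pow x k

  natR : ℕ → Carrier
  natR zero = 0#
  natR (suc k) = 1# + natR k

  sumFin : ∀ k → (Fin k → Carrier) → Carrier
  sumFin zero g = 0#
  sumFin (suc k) g = g zero + sumFin k (λ x → g (suc x))

  sumT : ∀ m → (Vec (Fin n) m → Carrier) → Carrier
  sumT zero G = G []
  sumT (suc m) G = sumFin n (λ a → sumT m (λ X → G (a ∷ X)))

  sumNZ : ∀ m → (Vec (Fin n) m → Carrier) → Carrier
  sumNZ zero G = G []
  sumNZ (suc m) G = sumFin n (λ { zero → 0# ; a → sumNZ m (λ T → G (a ∷ T)) })

  E : ∀ m → (Vec (Fin n) m → Carrier) → Carrier
  E m G = pow ninv m * sumT m G

  χ₁ : Fin n → Fin n → Carrier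
  χ₁ t x = pow ω (toℕ t ℕ.* toℕ x)

  -- conj(χ_t(x)) = ω^{-t x} = ω^{(n - t) x}
  χ₁bar : Fin n → Fin n → Carrier
  χ₁bar t x = pow ω ((n ∸ toℕ t) ℕ.* toℕ x)

  χ : ∀ {m} → Vec (Fin n) m → Vec (Fin n) m → Carrier
  χ [] [] = 1#
  χ (t ∷ T) (x ∷ X) = χ₁ t x * χ T X

  χbar : ∀ {m} → Vec (Fin n) m → Vec (Fin n) m → Carrier
  χbar [] [] = 1#
  χbar (t ∷ T) (x ∷ X) = χ₁bar t x * χbar T X

  hat : ∀ {m} → (Vec (Fin n) m → Carrier) → Vec (Fin n) m → Carrier
  hat {m} G T = E m (λ X → G X * χbar T X)

  -- (T₁,…,T_i) ↦ (T₁,…,T_i,0,…,0) ∈ [n]^m   (only used when i ≤ m)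
  pad : ∀ {i m} → Vec (Fin n) i → Vec (Fin n) m
  pad {m = zero} T = []
  pad {m = suc m} [] = 0F ∷ pad []
  pad {m = suc m} (t ∷ T) = t ∷ pad T

  f : ∀ {m} i → (Vec (Fin n) m → Carrier) → Vec (Fin n) i → Carrier
  f i G X = sumNZ i (λ T → hat G (pad T) * χ T X)

  -- F|_{a} (only used when ℓ ≥ 1)
  restrict1 : ∀ {L} → (Vec (Fin n) L → Carrier) → Fin n → Vec (Fin n) (L ∸ 1) → Carrier
  restrict1 {zero} F a X = F []
  restrict1 {suc L} F a X = F (a ∷ X)

  -- δ_A(F) = 𝔼_{X} F(A, X)   (only used when |A| ≤ ℓ)
  δ : ∀ {L r} → (Vec (Fin n) L → Carrier) → Vec (Fin n) r → Carrier
  δ {L} F [] = E L F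
  δ {zero} F (a ∷ A) = F []
  δ {suc L} F (a ∷ A) = δ (λ X → F (a ∷ X)) A

  sumSub : ∀ i → (Subset i → Carrier) → Carrier
  sumSub zero g = g []
  sumSub (suc i) g = sumSub i (λ B → g (inside ∷ B)) + sumSub i (λ B → g (outside ∷ B))

  PermInvariant : ∀ {L} → (Vec (Fin n) L → Carrier) → Set _
  PermInvariant {L} F = ∀ (π : Perm L) (X : Vec (Fin n) L) → F (permute π X) ≈ F X
    where
    open import Data.Fin.Permutation using (Permutation′; _⟨$⟩ʳ_)
    open import Data.Vec using (tabulate; lookup)
    Perm = Permutation′
    permute : ∀ {k} → Permutation′ k → Vec (Fin n) k → Vec (Fin n) k
    permute π X = tabulate (λ j → lookup X (π ⟨$⟩ʳ j))

{-# OPTIONS --safe #-}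
module Submission where

-- Along the first coordinate, f_{i+1,G}(x, X) is the one-variable Fourier series of y ↦ f_{i,G|y}(X)
-- with its constant term removed, i.e. f_{i,G|x}(X) minus the mean over y of f_{i,G|y}(X); this uses
-- only the orthogonality of the characters of [n]. Iterating, every coordinate of X is either fixed or
-- averaged, with a sign for each averaged one. For permutation-invariant F, averaging a coordinate
-- amounts to dropping it, which turns these terms into the δ_{X|B}(F) and proves (2); (1) is then the
-- difference of (2) at i+1 and at i.

open import Defs
open import Level using (Level)
open import Data.Nat using (ℕ; suc; _≤_; _<_; NonZero)
open import Data.Fin using (Fin; toℕ)
open import Data.Vec using (Vec; _∷_)
open import Data.Product using (_×_)
open import Relation.Binary.PropositionalEquality using (_≢_)
open import Algebra.Bundles using (CommutativeRing)

open import Data.Nat using (zero; z≤n; s≤s; _∸_; _%_; _/_)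
import Data.Nat as ℕ
import Data.Nat.Properties as ℕₚ
open import Data.Nat.Properties using (+-∸-assoc; m+[n∸m]≡n; m∸n+n≡m; m≤n⇒m≤1+n; <⇒≤; ≤-trans)
open import Data.Nat.DivMod using (_mod_; m≡m%n+[m/n]*n; m%n<n; m%n%n≡m%n; [m+n]%n≡m%n; m<n⇒m%n≡m; %-distribˡ-+)
open import Data.Nat.Tactic.RingSolver using (solve-∀)
import Data.Fin as Fin
open import Data.Fin.Properties using (toℕ<n; toℕ-injective; toℕ-fromℕ<; punchInᵢ≢i)
open import Data.Fin.Subset using (Subset; inside; outside)
open import Data.Fin.Permutation using (lift₀; transpose)
open import Data.Vec using ([])
open import Data.Vec.Properties using (tabulate∘lookup)
open import Data.Product using (_,_)
open import Function using (_∘_)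
open import Relation.Binary.PropositionalEquality as ≡ using (_≡_)
import Algebra.Properties.Ring as RingProperties
import Algebra.Properties.AbelianGroup as AbelianGroupProperties
import Algebra.Properties.CommutativeSemigroup as CommutativeSemigroupProperties
import Algebra.Properties.Semiring.Sum as SemiringSum

-- A representative of x − y modulo n.
shift : ∀ {n} → Fin n → Fin n → ℕ
shift {n} x y = (n ∸ toℕ y) ℕ.+ toℕ x

toℕ+shift : ∀ {n} (x y : Fin n) → toℕ y ℕ.+ shift x y ≡ n ℕ.+ toℕ x
toℕ+shift x y = ≡.trans (≡.sym (ℕₚ.+-assoc (toℕ y) _ _)) (≡.cong (ℕ._+ toℕ x) (m+[n∸m]≡n (<⇒≤ (toℕ<n y))))

shift%n≢0 : ∀ {n} .{{_ : NonZero n}} {x y : Fin n} → x ≢ y → shift x y % n ≢ 0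
shift%n≢0 {n} {x} {y} x≢y shift≡0 = x≢y (toℕ-injective (begin
  toℕ x                             ≡⟨ m<n⇒m%n≡m (toℕ<n x) ⟨
  toℕ x % n                         ≡⟨ [m+n]%n≡m%n (toℕ x) n ⟨
  (toℕ x ℕ.+ n) % n                 ≡⟨ ≡.cong (_% n) (≡.trans (ℕₚ.+-comm (toℕ x) n) (≡.sym (toℕ+shift x y))) ⟩
  (toℕ y ℕ.+ shift x y) % n         ≡⟨ %-distribˡ-+ (toℕ y) (shift x y) n ⟩
  (toℕ y % n ℕ.+ shift x y % n) % n ≡⟨ ≡.cong (λ r → (toℕ y % n ℕ.+ r) % n) shift≡0 ⟩
  (toℕ y % n ℕ.+ 0) % n             ≡⟨ ≡.cong (_% n) (ℕₚ.+-identityʳ (toℕ y % n)) ⟩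
  toℕ y % n % n                     ≡⟨ m%n%n≡m%n (toℕ y) n ⟩
  toℕ y % n                         ≡⟨ m<n⇒m%n≡m (toℕ<n y) ⟩
  toℕ y                             ∎))
  where open ≡.≡-Reasoning

module FourierProperties {c ℓ : Level} (R : CommutativeRing c ℓ) (n′ : ℕ) (ω ninv : CommutativeRing.Carrier R) where

  open CommutativeRing R hiding (zero)
  open RingProperties ring using (-1*x≈-x)
  open AbelianGroupProperties +-abelianGroup using (xyx⁻¹≈y)
  open CommutativeSemigroupProperties *-commutativeSemigroup using (x∙yz≈y∙xz)
  open SemiringSum semiring using (sum; sum-cong-≋; ∑-distrib-+; ∑-comm; *-distribˡ-sum; *-distribʳ-sum; sum-remove; sum-replicate-zero)
  open import Relation.Binary.Reasoning.Setoid setoid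

  n : ℕ
  n = suc n′

  open Fourier R n ω ninv

  V : ℕ → Set
  V = Vec (Fin n)

  restrict : ∀ {L} → (V (suc L) → Carrier) → Fin n → V L → Carrier
  restrict G a X = G (a ∷ X)

  mean : (Fin n → Carrier) → Carrier
  mean φ = ninv * sumFin n φ

  coeff : (Fin n → Carrier) → Fin n → Carrier
  coeff φ t = ninv * sumFin n (λ y → χ₁bar t y * φ y)

  sumFin≈sum : ∀ {k} (g : Fin k → Carrier) → sumFin k g ≈ sum g
  sumFin≈sum {zero} g = refl
  sumFin≈sum {suc k} g = +-congˡ (sumFin≈sum (g ∘ Fin.suc))

  sumFin-cong : ∀ k {g h : Fin k → Carrier} → (∀ x → g x ≈ h x) → sumFin k g ≈ sumFin k h
  sumFin-cong k {g} {h} g≈h = trans (sumFin≈sum g) (trans (sum-cong-≋ g≈h) (sym (sumFin≈sum h)))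

  sumFin-+ : ∀ k (g h : Fin k → Carrier) → sumFin k (λ x → g x + h x) ≈ sumFin k g + sumFin k h
  sumFin-+ k g h = trans (sumFin≈sum (λ x → g x + h x)) (trans (∑-distrib-+ g h) (sym (+-cong (sumFin≈sum g) (sumFin≈sum h))))

  *-distribˡ-sumFin : ∀ k a (g : Fin k → Carrier) → a * sumFin k g ≈ sumFin k (λ x → a * g x)
  *-distribˡ-sumFin k a g = trans (*-congˡ (sumFin≈sum g)) (trans (*-distribˡ-sum a g) (sym (sumFin≈sum (λ x → a * g x))))

  *-distribʳ-sumFin : ∀ k a (g : Fin k → Carrier) → sumFin k g * a ≈ sumFin k (λ x → g x * a)
  *-distribʳ-sumFin k a g = trans (*-congʳ (sumFin≈sum g)) (trans (*-distribʳ-sum a g) (sym (sumFin≈sum (λ x → g x * a))))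

  sumFin-comm : ∀ k j (g : Fin k → Fin j → Carrier) →
    sumFin k (λ x → sumFin j (g x)) ≈ sumFin j (λ y → sumFin k (λ x → g x y))
  sumFin-comm k j g = begin
    sumFin k (λ x → sumFin j (g x))         ≈⟨ double-sumFin≈sum g ⟩
    sum (λ x → sum (g x))                   ≈⟨ ∑-comm g ⟩
    sum (λ y → sum (λ x → g x y))           ≈⟨ double-sumFin≈sum (λ y x → g x y) ⟨
    sumFin j (λ y → sumFin k (λ x → g x y)) ∎
    where
    double-sumFin≈sum : ∀ {k j} (h : Fin k → Fin j → Carrier) → sumFin k (λ x → sumFin j (h x)) ≈ sum (λ x → sum (h x))
    double-sumFin≈sum h = trans (sumFin≈sum (λ x → sumFin _ (h x))) (sum-cong-≋ (λ x → sumFin≈sum (h x)))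

  sumFin-single : ∀ k (x : Fin k) (g : Fin k → Carrier) → (∀ y → y ≢ x → g y ≈ 0#) → sumFin k g ≈ g x
  sumFin-single (suc k) x g g≈0 = begin
    sumFin (suc k) g                      ≈⟨ sumFin≈sum g ⟩
    sum g                                 ≈⟨ sum-remove {i = x} g ⟩
    g x + sum (g ∘ Fin.punchIn x)         ≈⟨ +-congˡ (sum-cong-≋ (λ j → g≈0 _ (punchInᵢ≢i x j))) ⟩
    g x + sum {k} (λ _ → 0#)              ≈⟨ +-congˡ (sum-replicate-zero k) ⟩
    g x + 0#                              ≈⟨ +-identityʳ (g x) ⟩
    g x                                   ∎

  sumFin-ones : ∀ k → sumFin k (λ _ → 1#) ≈ natR k
  sumFin-ones zero = refl
  sumFin-ones (suc k) = +-congˡ (sumFin-ones k)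

  mean-cong : ∀ {φ ψ : Fin n → Carrier} → (∀ y → φ y ≈ ψ y) → mean φ ≈ mean ψ
  mean-cong φ≈ψ = *-congˡ (sumFin-cong n φ≈ψ)

  sumT-cong : ∀ m {G H : V m → Carrier} → (∀ X → G X ≈ H X) → sumT m G ≈ sumT m H
  sumT-cong zero G≈H = G≈H []
  sumT-cong (suc m) G≈H = sumFin-cong n (λ a → sumT-cong m (λ X → G≈H (a ∷ X)))

  *-distribˡ-sumT : ∀ m a (G : V m → Carrier) → a * sumT m G ≈ sumT m (λ X → a * G X)
  *-distribˡ-sumT zero a G = refl
  *-distribˡ-sumT (suc m) a G =
    trans (*-distribˡ-sumFin n a (λ y → sumT m (restrict G y))) (sumFin-cong n (λ y → *-distribˡ-sumT m a (restrict G y)))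

  sumNZ-suc : ∀ m (G : V (suc m) → Carrier) →
    sumNZ (suc m) G ≈ sumFin n′ (λ a → sumNZ m (λ T → G (Fin.suc a ∷ T)))
  sumNZ-suc m G = +-identityˡ _

  sumNZ-cong : ∀ m {G H : V m → Carrier} → (∀ T → G T ≈ H T) → sumNZ m G ≈ sumNZ m H
  sumNZ-cong zero G≈H = G≈H []
  sumNZ-cong (suc m) G≈H = +-congˡ (sumFin-cong n′ (λ a → sumNZ-cong m (λ T → G≈H (Fin.suc a ∷ T))))

  *-distribˡ-sumNZ : ∀ m a (G : V m → Carrier) → a * sumNZ m G ≈ sumNZ m (λ T → a * G T)
  *-distribˡ-sumNZ zero a G = refl
  *-distribˡ-sumNZ (suc m) a G = begin
    a * sumNZ (suc m) G                                    ≈⟨ *-congˡ (sumNZ-suc m G) ⟩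
    a * sumFin n′ (λ x → sumNZ m (λ T → G (Fin.suc x ∷ T))) ≈⟨ *-distribˡ-sumFin n′ a _ ⟩
    sumFin n′ (λ x → a * sumNZ m (λ T → G (Fin.suc x ∷ T))) ≈⟨ sumFin-cong n′ (λ x → *-distribˡ-sumNZ m a _) ⟩
    sumFin n′ (λ x → sumNZ m (λ T → a * G (Fin.suc x ∷ T))) ≈⟨ sumNZ-suc m (λ T → a * G T) ⟨
    sumNZ (suc m) (λ T → a * G T)                          ∎

  sumNZ-sumFin-comm : ∀ m k (g : V m → Fin k → Carrier) →
    sumNZ m (λ T → sumFin k (g T)) ≈ sumFin k (λ y → sumNZ m (λ T → g T y))
  sumNZ-sumFin-comm zero k g = refl
  sumNZ-sumFin-comm (suc m) k g = begin
    sumNZ (suc m) (λ T → sumFin k (g T))                                   ≈⟨ sumNZ-suc m (λ T → sumFin k (g T)) ⟩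
    sumFin n′ (λ a → sumNZ m (λ T → sumFin k (g (Fin.suc a ∷ T))))           ≈⟨ sumFin-cong n′ (λ a → sumNZ-sumFin-comm m k _) ⟩
    sumFin n′ (λ a → sumFin k (λ y → sumNZ m (λ T → g (Fin.suc a ∷ T) y)))   ≈⟨ sumFin-comm n′ k _ ⟩
    sumFin k (λ y → sumFin n′ (λ a → sumNZ m (λ T → g (Fin.suc a ∷ T) y)))   ≈⟨ sumFin-cong k (λ y → sumNZ-suc m (λ T → g T y)) ⟨
    sumFin k (λ y → sumNZ (suc m) (λ T → g T y))                           ∎

  sumSub-cong : ∀ i {g h : Subset i → Carrier} → (∀ B → g B ≈ h B) → sumSub i g ≈ sumSub i h
  sumSub-cong zero g≈h = g≈h []
  sumSub-cong (suc i) g≈h = +-cong (sumSub-cong i (g≈h ∘ (inside ∷_))) (sumSub-cong i (g≈h ∘ (outside ∷_)))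

  *-distribˡ-sumSub : ∀ i a (g : Subset i → Carrier) → a * sumSub i g ≈ sumSub i (λ B → a * g B)
  *-distribˡ-sumSub zero a g = refl
  *-distribˡ-sumSub (suc i) a g = trans (distribˡ a _ _) (+-cong (*-distribˡ-sumSub i a _) (*-distribˡ-sumSub i a _))

  sumSub-sumFin-comm : ∀ i k (g : Subset i → Fin k → Carrier) →
    sumSub i (λ B → sumFin k (g B)) ≈ sumFin k (λ y → sumSub i (λ B → g B y))
  sumSub-sumFin-comm zero k g = refl
  sumSub-sumFin-comm (suc i) k g =
    trans (+-cong (sumSub-sumFin-comm i k _) (sumSub-sumFin-comm i k _)) (sym (sumFin-+ k _ _))

  pow-+ : ∀ x a b → pow x (a ℕ.+ b) ≈ pow x a * pow x b
  pow-+ x zero b = sym (*-identityˡ _)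
  pow-+ x (suc a) b = trans (*-congˡ (pow-+ x a b)) (sym (*-assoc x _ _))

  hat-cons : ∀ {m} (G : V (suc m) → Carrier) t (P : V m) → hat G (t ∷ P) ≈ coeff (λ y → hat (restrict G y) P) t
  hat-cons {m} G t P = begin
    (ninv * pow ninv m) * sumFin n (λ y → sumT m (h y))  ≈⟨ *-assoc _ _ _ ⟩
    ninv * (pow ninv m * sumFin n (λ y → sumT m (h y)))  ≈⟨ *-congˡ (*-distribˡ-sumFin n (pow ninv m) (λ y → sumT m (h y))) ⟩
    ninv * sumFin n (λ y → pow ninv m * sumT m (h y))    ≈⟨ *-congˡ (sumFin-cong n pull-character) ⟩
    coeff (λ y → hat (restrict G y) P) t                 ∎
    where
    h : Fin n → V m → Carrier
    h y Y = G (y ∷ Y) * (χ₁bar t y * χbar P Y)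
    pull-character : ∀ y → pow ninv m * sumT m (h y) ≈ χ₁bar t y * hat (restrict G y) P
    pull-character y = begin
      pow ninv m * sumT m (h y)                                           ≈⟨ *-congˡ (sumT-cong m (λ Y → x∙yz≈y∙xz _ _ _)) ⟩
      pow ninv m * sumT m (λ Y → χ₁bar t y * (G (y ∷ Y) * χbar P Y))      ≈⟨ *-congˡ (*-distribˡ-sumT m (χ₁bar t y) _) ⟨
      pow ninv m * (χ₁bar t y * sumT m (λ Y → G (y ∷ Y) * χbar P Y))      ≈⟨ x∙yz≈y∙xz _ _ _ ⟩
      χ₁bar t y * hat (restrict G y) P                                    ∎

  coeff-sumNZ : ∀ i (g : V i → Fin n → Carrier) (w : V i → Carrier) t →
    sumNZ i (λ T → coeff (g T) t * w T) ≈ coeff (λ y → sumNZ i (λ T → g T y * w T)) t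
  coeff-sumNZ i g w t = begin
    sumNZ i (λ T → coeff (g T) t * w T)            ≈⟨ sumNZ-cong i pull-weight ⟩
    sumNZ i (λ T → ninv * sumFin n (term T))       ≈⟨ *-distribˡ-sumNZ i ninv (λ T → sumFin n (term T)) ⟨
    ninv * sumNZ i (λ T → sumFin n (term T))       ≈⟨ *-congˡ (sumNZ-sumFin-comm i n term) ⟩
    ninv * sumFin n (λ y → sumNZ i (λ T → term T y))
      ≈⟨ *-congˡ (sumFin-cong n (λ y → *-distribˡ-sumNZ i (χ₁bar t y) (λ T → g T y * w T))) ⟨
    coeff (λ y → sumNZ i (λ T → g T y * w T)) t    ∎
    where
    term : V i → Fin n → Carrier
    term T y = χ₁bar t y * (g T y * w T)
    pull-weight : ∀ T → coeff (g T) t * w T ≈ ninv * sumFin n (term T)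
    pull-weight T = trans (*-assoc _ _ _) (*-congˡ (trans (*-distribʳ-sumFin n (w T) (λ y → χ₁bar t y * g T y))
      (sumFin-cong n (λ y → *-assoc (χ₁bar t y) (g T y) (w T)))))

  PermInvariant-restrict : ∀ {L} {G : V (suc L) → Carrier} → PermInvariant G → ∀ a → PermInvariant (restrict G a)
  PermInvariant-restrict G-inv a π X = G-inv (lift₀ π) (a ∷ X)

  PermInvariant-swap : ∀ {L} {G : V (suc (suc L)) → Carrier} → PermInvariant G →
    ∀ a b Z → G (a ∷ b ∷ Z) ≈ G (b ∷ a ∷ Z)
  PermInvariant-swap {G = G} G-inv a b Z =
    sym (trans (reflexive (≡.cong (λ W → G (b ∷ a ∷ W)) (≡.sym (tabulate∘lookup Z))))
               (G-inv (transpose Fin.zero (Fin.suc Fin.zero)) (a ∷ b ∷ Z)))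

  δ-cong : ∀ {L r} {G H : V L → Carrier} → (∀ X → G X ≈ H X) → (A : V r) → δ G A ≈ δ H A
  δ-cong {L} G≈H [] = *-congˡ (sumT-cong L G≈H)
  δ-cong {zero} G≈H (a ∷ A) = G≈H []
  δ-cong {suc L} G≈H (a ∷ A) = δ-cong (G≈H ∘ (a ∷_)) A

  -- Permutation invariance moves the averaged coordinate past the fixed ones.
  mean-δ-cons : ∀ {L r} (G : V L → Carrier) → PermInvariant G → suc r ≤ L → (A : V r) →
    mean (λ y → δ G (y ∷ A)) ≈ δ G A
  mean-δ-cons {suc L} G G-inv r<L [] =
    trans (*-congˡ (sym (*-distribˡ-sumFin n (pow ninv L) (λ y → sumT L (restrict G y))))) (sym (*-assoc _ _ _))
  mean-δ-cons {suc (suc L)} G G-inv (s≤s r<L) (a ∷ A) =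
    trans (mean-cong (λ y → δ-cong (PermInvariant-swap G-inv y a) A))
          (mean-δ-cons (restrict G a) (PermInvariant-restrict G-inv a) r<L A)

  size≤ : ∀ {i} (B : Subset i) → size B ≤ i
  size≤ [] = z≤n
  size≤ (inside ∷ B) = s≤s (size≤ B)
  size≤ (outside ∷ B) = m≤n⇒m≤1+n (size≤ B)

  sign : ∀ i → Subset i → Carrier
  sign i B = pow (- 1#) (i ∸ size B)

  sign-suc : ∀ i (B : Subset i) → pow (- 1#) (suc i ∸ size B) ≈ - 1# * sign i B
  sign-suc i B = reflexive (≡.cong (pow (- 1#)) (+-∸-assoc 1 (size≤ B)))

  inclusionExclusion : ∀ {L} i → (V L → Carrier) → V i → Carrier
  inclusionExclusion i G X = sumSub i (λ B → sign i B * δ G (select B X))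

  inclusionExclusion-cons : ∀ {L} i (G : V (suc L) → Carrier) x X →
    inclusionExclusion (suc i) G (x ∷ X) ≈ inclusionExclusion i (restrict G x) X - inclusionExclusion i G X
  inclusionExclusion-cons i G x X = +-congˡ (begin
    sumSub i (λ B → pow (- 1#) (suc i ∸ size B) * δ G (select B X))
      ≈⟨ sumSub-cong i (λ B → trans (*-congʳ (sign-suc i B)) (*-assoc _ _ _)) ⟩
    sumSub i (λ B → - 1# * (sign i B * δ G (select B X)))             ≈⟨ *-distribˡ-sumSub i (- 1#) _ ⟨
    - 1# * inclusionExclusion i G X                                   ≈⟨ -1*x≈-x _ ⟩
    - inclusionExclusion i G X                                        ∎)

  mean-sumSub : ∀ i (s : Subset i → Carrier) (h : Fin n → Subset i → Carrier) →
    mean (λ y → sumSub i (λ B → s B * h y B)) ≈ sumSub i (λ B → s B * mean (λ y → h y B))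
  mean-sumSub i s h = begin
    ninv * sumFin n (λ y → sumSub i (λ B → s B * h y B))      ≈⟨ *-congˡ (sumSub-sumFin-comm i n (λ B y → s B * h y B)) ⟨
    ninv * sumSub i (λ B → sumFin n (λ y → s B * h y B))      ≈⟨ *-distribˡ-sumSub i ninv _ ⟩
    sumSub i (λ B → ninv * sumFin n (λ y → s B * h y B))      ≈⟨ sumSub-cong i (λ B → *-congˡ (*-distribˡ-sumFin n (s B) (λ y → h y B))) ⟨
    sumSub i (λ B → ninv * (s B * sumFin n (λ y → h y B)))    ≈⟨ sumSub-cong i (λ B → x∙yz≈y∙xz _ _ _) ⟩
    sumSub i (λ B → s B * mean (λ y → h y B))                 ∎

  mean-inclusionExclusion : ∀ {L} (G : V (suc L) → Carrier) → PermInvariant G → ∀ {i} → i ≤ L → (X : V i) →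
    mean (λ y → inclusionExclusion i (restrict G y) X) ≈ inclusionExclusion i G X
  mean-inclusionExclusion G G-inv {i} i≤L X =
    trans (mean-sumSub i (sign i) (λ y B → δ G (y ∷ select B X)))
          (sumSub-cong i (λ B → *-congˡ (mean-δ-cons G G-inv (s≤s (≤-trans (size≤ B) i≤L)) (select B X))))

  module Inversion (ninv*n≈1 : ninv * natR n ≈ 1#) (ωⁿ≈1 : pow ω n ≈ 1#)
                   (orthogonal : ∀ (t : Fin n) → toℕ t ≢ 0 → sumFin n (λ x → pow ω (toℕ t ℕ.* toℕ x)) ≈ 0#) where

    pow-multiple : ∀ k → pow ω (k ℕ.* n) ≈ 1#
    pow-multiple zero = refl
    pow-multiple (suc k) = trans (pow-+ ω n (k ℕ.* n)) (trans (*-cong ωⁿ≈1 (pow-multiple k)) (*-identityˡ 1#))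

    pow-+-multiple : ∀ m k → pow ω (m ℕ.+ k ℕ.* n) ≈ pow ω m
    pow-+-multiple m k = trans (pow-+ ω m (k ℕ.* n)) (trans (*-congˡ (pow-multiple k)) (*-identityʳ _))

    χ₁bar-inverse : ∀ t x → χ₁bar t x * χ₁ t x ≈ 1#
    χ₁bar-inverse t x = begin
      pow ω ((n ∸ toℕ t) ℕ.* toℕ x) * pow ω (toℕ t ℕ.* toℕ x)  ≈⟨ pow-+ ω ((n ∸ toℕ t) ℕ.* toℕ x) (toℕ t ℕ.* toℕ x) ⟨
      pow ω ((n ∸ toℕ t) ℕ.* toℕ x ℕ.+ toℕ t ℕ.* toℕ x)        ≡⟨ ≡.cong (pow ω) exponent ⟩
      pow ω (toℕ x ℕ.* n)                                      ≈⟨ pow-multiple (toℕ x) ⟩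
      1#                                                       ∎
      where
      exponent : (n ∸ toℕ t) ℕ.* toℕ x ℕ.+ toℕ t ℕ.* toℕ x ≡ toℕ x ℕ.* n
      exponent = ≡.trans (≡.sym (ℕₚ.*-distribʳ-+ (toℕ x) (n ∸ toℕ t) (toℕ t)))
                         (≡.trans (≡.cong (ℕ._* toℕ x) (m∸n+n≡m (<⇒≤ (toℕ<n t)))) (ℕₚ.*-comm n (toℕ x)))

    χ₁bar-zero : ∀ x → χ₁bar Fin.zero x ≈ 1#
    χ₁bar-zero x = trans (reflexive (≡.cong (pow ω) (ℕₚ.*-comm n (toℕ x)))) (pow-multiple (toℕ x))

    χbar-zero : ∀ m (X : V m) → χbar (pad {0} {m} []) X ≈ 1#
    χbar-zero zero [] = refl
    χbar-zero (suc m) (x ∷ X) = trans (*-cong (χ₁bar-zero x) (χbar-zero m X)) (*-identityˡ 1#)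

    character-sum-vanishes : ∀ e → e % n ≢ 0 → sumFin n (λ t → pow ω (toℕ t ℕ.* e)) ≈ 0#
    character-sum-vanishes e e≢0 = trans (sumFin-cong n reduce) (orthogonal (e mod n) (e≢0 ∘ ≡.trans (≡.sym (toℕ-fromℕ< (m%n<n e n)))))
      where
      reduce : ∀ t → pow ω (toℕ t ℕ.* e) ≈ pow ω (toℕ (e mod n) ℕ.* toℕ t)
      reduce t = begin
        pow ω (toℕ t ℕ.* e)                             ≡⟨ ≡.cong (λ u → pow ω (toℕ t ℕ.* u)) (m≡m%n+[m/n]*n e n) ⟩
        pow ω (toℕ t ℕ.* (e % n ℕ.+ e / n ℕ.* n))           ≡⟨ ≡.cong (pow ω) (split (toℕ t) (e % n) (e / n) n) ⟩
        pow ω ((e % n) ℕ.* toℕ t ℕ.+ (toℕ t ℕ.* (e / n)) ℕ.* n) ≈⟨ pow-+-multiple ((e % n) ℕ.* toℕ t) (toℕ t ℕ.* (e / n)) ⟩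
        pow ω ((e % n) ℕ.* toℕ t)                       ≡⟨ ≡.cong (λ u → pow ω (u ℕ.* toℕ t)) (toℕ-fromℕ< (m%n<n e n)) ⟨
        pow ω (toℕ (e mod n) ℕ.* toℕ t)                 ∎
        where
        split : ∀ a r q m → a ℕ.* (r ℕ.+ q ℕ.* m) ≡ r ℕ.* a ℕ.+ (a ℕ.* q) ℕ.* m
        split = solve-∀

    χ₁-shift : ∀ t x y → χ₁ t x ≈ χ₁ t y * pow ω (toℕ t ℕ.* shift x y)
    χ₁-shift t x y = sym (begin
      pow ω (toℕ t ℕ.* toℕ y) * pow ω (toℕ t ℕ.* shift x y) ≈⟨ pow-+ ω (toℕ t ℕ.* toℕ y) (toℕ t ℕ.* shift x y) ⟨
      pow ω (toℕ t ℕ.* toℕ y ℕ.+ toℕ t ℕ.* shift x y)         ≡⟨ ≡.cong (pow ω) exponent ⟩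
      pow ω (toℕ t ℕ.* toℕ x ℕ.+ toℕ t ℕ.* n)                 ≈⟨ pow-+-multiple (toℕ t ℕ.* toℕ x) (toℕ t) ⟩
      pow ω (toℕ t ℕ.* toℕ x)                             ∎)
      where
      exponent : toℕ t ℕ.* toℕ y ℕ.+ toℕ t ℕ.* shift x y ≡ toℕ t ℕ.* toℕ x ℕ.+ toℕ t ℕ.* n
      exponent = ≡.trans (≡.sym (ℕₚ.*-distribˡ-+ (toℕ t) (toℕ y) _))
                 (≡.trans (≡.cong (toℕ t ℕ.*_) (≡.trans (toℕ+shift x y) (ℕₚ.+-comm n (toℕ x))))
                          (ℕₚ.*-distribˡ-+ (toℕ t) (toℕ x) n))

    orthogonality-≡ : ∀ x → sumFin n (λ t → χ₁bar t x * χ₁ t x) ≈ natR n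
    orthogonality-≡ x = trans (sumFin-cong n (λ t → χ₁bar-inverse t x)) (sumFin-ones n)

    orthogonality-≢ : ∀ x y → x ≢ y → sumFin n (λ t → χ₁bar t y * χ₁ t x) ≈ 0#
    orthogonality-≢ x y x≢y =
      trans (sumFin-cong n cancel-y) (character-sum-vanishes (shift x y) (shift%n≢0 x≢y))
      where
      cancel-y : ∀ t → χ₁bar t y * χ₁ t x ≈ pow ω (toℕ t ℕ.* shift x y)
      cancel-y t = trans (*-congˡ (χ₁-shift t x y))
                         (trans (sym (*-assoc _ _ _)) (trans (*-congʳ (χ₁bar-inverse t y)) (*-identityˡ _)))

    fourier-inversion : ∀ (φ : Fin n → Carrier) x → sumFin n (λ t → χ₁ t x * coeff φ t) ≈ φ x
    fourier-inversion φ x = begin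
      sumFin n (λ t → χ₁ t x * coeff φ t)                        ≈⟨ sumFin-cong n expand ⟩
      sumFin n (λ t → ninv * sumFin n (λ y → kernel y t * φ y))  ≈⟨ *-distribˡ-sumFin n ninv (λ t → sumFin n (λ y → kernel y t * φ y)) ⟨
      ninv * sumFin n (λ t → sumFin n (λ y → kernel y t * φ y))  ≈⟨ *-congˡ (sumFin-comm n n (λ t y → kernel y t * φ y)) ⟩
      ninv * sumFin n (λ y → sumFin n (λ t → kernel y t * φ y))  ≈⟨ *-congˡ (sumFin-cong n (λ y → *-distribʳ-sumFin n (φ y) (kernel y))) ⟨
      ninv * sumFin n (λ y → sumFin n (kernel y) * φ y)          ≈⟨ *-congˡ (sumFin-single n x (λ y → sumFin n (kernel y) * φ y) off-diagonal) ⟩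
      ninv * (sumFin n (kernel x) * φ x)                         ≈⟨ *-congˡ (*-congʳ (orthogonality-≡ x)) ⟩
      ninv * (natR n * φ x)                                      ≈⟨ *-assoc _ _ _ ⟨
      (ninv * natR n) * φ x                                      ≈⟨ *-congʳ ninv*n≈1 ⟩
      1# * φ x                                                   ≈⟨ *-identityˡ (φ x) ⟩
      φ x                                                        ∎
      where
      kernel : Fin n → Fin n → Carrier
      kernel y t = χ₁bar t y * χ₁ t x
      expand : ∀ t → χ₁ t x * coeff φ t ≈ ninv * sumFin n (λ y → kernel y t * φ y)
      expand t = trans (x∙yz≈y∙xz _ _ _) (*-congˡ (trans (*-distribˡ-sumFin n (χ₁ t x) (λ y → χ₁bar t y * φ y))
        (sumFin-cong n (λ y → trans (x∙yz≈y∙xz (χ₁ t x) (χ₁bar t y) (φ y)) (sym (*-assoc (χ₁bar t y) (χ₁ t x) (φ y)))))))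
      off-diagonal : ∀ y → y ≢ x → sumFin n (kernel y) * φ y ≈ 0#
      off-diagonal y y≢x = trans (*-congʳ (orthogonality-≢ x y (y≢x ∘ ≡.sym))) (zeroˡ (φ y))

    fourier-nonzero-modes : ∀ (φ : Fin n → Carrier) x →
      sumFin n′ (λ a → χ₁ (Fin.suc a) x * coeff φ (Fin.suc a)) ≈ φ x - mean φ
    fourier-nonzero-modes φ x = sym (begin
      φ x - mean φ                                    ≈⟨ +-congʳ (fourier-inversion φ x) ⟨
      (zero-mode + nonzero-modes) - mean φ            ≈⟨ +-congˡ (-‿cong zero-mode≈mean) ⟨
      (zero-mode + nonzero-modes) - zero-mode         ≈⟨ xyx⁻¹≈y zero-mode nonzero-modes ⟩
      nonzero-modes                                   ∎)
      where
      zero-mode nonzero-modes : Carrier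
      zero-mode = χ₁ Fin.zero x * coeff φ Fin.zero
      nonzero-modes = sumFin n′ (λ a → χ₁ (Fin.suc a) x * coeff φ (Fin.suc a))
      zero-mode≈mean : zero-mode ≈ mean φ
      zero-mode≈mean = trans (*-identityˡ _)
        (*-congˡ (sumFin-cong n (λ y → trans (*-congʳ (χ₁bar-zero y)) (*-identityˡ (φ y)))))

    f-zero : ∀ {m} (G : V m → Carrier) → f 0 G [] ≈ E m G
    f-zero {m} G = trans (*-identityʳ _)
      (*-congˡ (sumT-cong m (λ X → trans (*-congˡ (χbar-zero m X)) (*-identityʳ (G X)))))

    f-suc : ∀ {m} i (G : V (suc m) → Carrier) x (X : V i) →
      f (suc i) G (x ∷ X) ≈ f i (restrict G x) X - mean (λ y → f i (restrict G y) X)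
    f-suc i G x X = begin
      f (suc i) G (x ∷ X)                                                  ≈⟨ sumNZ-suc i (λ T → hat G (pad T) * χ T (x ∷ X)) ⟩
      sumFin n′ (λ a → sumNZ i (λ T → hat G (Fin.suc a ∷ pad T) * (χ₁ (Fin.suc a) x * χ T X)))
        ≈⟨ sumFin-cong n′ (λ a → pull-character (Fin.suc a)) ⟩
      sumFin n′ (λ a → χ₁ (Fin.suc a) x * sumNZ i (coefficientTerm (Fin.suc a)))
        ≈⟨ sumFin-cong n′ (λ a → *-congˡ (coefficient (Fin.suc a))) ⟩
      sumFin n′ (λ a → χ₁ (Fin.suc a) x * coeff φ (Fin.suc a))             ≈⟨ fourier-nonzero-modes φ x ⟩
      φ x - mean φ                                                         ∎
      where
      φ : Fin n → Carrier
      φ y = f i (restrict G y) X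
      coefficientTerm : Fin n → V i → Carrier
      coefficientTerm t T = hat G (t ∷ pad T) * χ T X
      pull-character : ∀ t → sumNZ i (λ T → hat G (t ∷ pad T) * (χ₁ t x * χ T X)) ≈ χ₁ t x * sumNZ i (coefficientTerm t)
      pull-character t = trans (sumNZ-cong i (λ T → x∙yz≈y∙xz _ _ _)) (sym (*-distribˡ-sumNZ i (χ₁ t x) (coefficientTerm t)))
      coefficient : ∀ t → sumNZ i (coefficientTerm t) ≈ coeff φ t
      coefficient t = trans (sumNZ-cong i (λ T → *-congʳ (hat-cons G t (pad T))))
                            (coeff-sumNZ i (λ T y → hat (restrict G y) (pad T)) (λ T → χ T X) t)

    f≈inclusionExclusion : ∀ {L} (G : V L → Carrier) → PermInvariant G → ∀ {i} → i ≤ L → (X : V i) →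
      f i G X ≈ inclusionExclusion i G X
    f≈inclusionExclusion G G-inv {zero} _ [] = trans (f-zero G) (sym (*-identityˡ _))
    f≈inclusionExclusion G G-inv {suc i} (s≤s i≤L) (x ∷ X) = begin
      f (suc i) G (x ∷ X)                                                              ≈⟨ f-suc i G x X ⟩
      f i (restrict G x) X - mean (λ y → f i (restrict G y) X)                         ≈⟨ +-cong (IH x) (-‿cong (mean-cong IH)) ⟩
      inclusionExclusion i (restrict G x) X - mean (λ y → inclusionExclusion i (restrict G y) X)
        ≈⟨ +-congˡ (-‿cong (mean-inclusionExclusion G G-inv i≤L X)) ⟩
      inclusionExclusion i (restrict G x) X - inclusionExclusion i G X                 ≈⟨ inclusionExclusion-cons i G x X ⟨
      inclusionExclusion (suc i) G (x ∷ X)                                             ∎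
      where
      IH : ∀ y → f i (restrict G y) X ≈ inclusionExclusion i (restrict G y) X
      IH y = f≈inclusionExclusion (restrict G y) (PermInvariant-restrict G-inv y) i≤L X

    f-suc-restrict : ∀ {L} (G : V (suc L) → Carrier) → PermInvariant G → ∀ a {i} → i ≤ L → (X : V i) →
      f (suc i) G (a ∷ X) ≈ f i (restrict G a) X - f i G X
    f-suc-restrict G G-inv a {i} i≤L X = begin
      f (suc i) G (a ∷ X)                                                    ≈⟨ f≈inclusionExclusion G G-inv (s≤s i≤L) (a ∷ X) ⟩
      inclusionExclusion (suc i) G (a ∷ X)                                   ≈⟨ inclusionExclusion-cons i G a X ⟩
      inclusionExclusion i (restrict G a) X - inclusionExclusion i G X
        ≈⟨ +-cong (f≈inclusionExclusion (restrict G a) (PermInvariant-restrict G-inv a) i≤L X)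
                  (-‿cong (f≈inclusionExclusion G G-inv (m≤n⇒m≤1+n i≤L) X)) ⟨
      f i (restrict G a) X - f i G X                                         ∎

lemmaC10 : ∀ {c ℓ' : Level} (R : CommutativeRing c ℓ') →
    let open CommutativeRing R in
    (n : ℕ) .{{_ : NonZero n}} (ω ninv : Carrier) →
    let open Fourier R n ω ninv in
    ninv * natR n ≈ 1# →
    pow ω n ≈ 1# →
    (∀ (t : Fin n) → toℕ t ≢ 0 → sumFin n (λ x → pow ω (toℕ t Data.Nat.* toℕ x)) ≈ 0#) →
    (ℓ : ℕ) → ℓ < n →
    (F : Vec (Fin n) ℓ → Carrier) → PermInvariant F →
    (∀ (a : Fin n) (i : ℕ) → suc i ≤ ℓ → (X : Vec (Fin n) i) →
       f (suc i) F (a ∷ X) ≈ f i (restrict1 F a) X - f i F X)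
    ×
    (∀ (i : ℕ) → i ≤ ℓ → (X : Vec (Fin n) i) →
       f i F X ≈ sumSub i (λ B → pow (- 1#) (i Data.Nat.∸ size B) * δ F (select B X)))
lemmaC10 R zero {{()}}
lemmaC10 R (suc n′) ω ninv ninv*n≈1 ωⁿ≈1 orthogonal ℓ _ F F-inv =
  (λ { a i (s≤s i≤ℓ) X → f-suc-restrict F F-inv a i≤ℓ X }) ,
  (λ i i≤ℓ X → f≈inclusionExclusion F F-inv i≤ℓ X)
  where
  open FourierProperties R n′ ω ninv
  open Inversion ninv*n≈1 ωⁿ≈1 orthogonal
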